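{- Let $p$ be a prime with $p\notin\{2,5\}$, let $\alpha\ge 1$ be an integer (so $p^\alpha$ is a prime power), and let $k,L\geq1$ be integers. Then \[ h_{p^\alpha,Lk} \;=\; \frac{h_{p^{\alpha+\operatorname{ord}_p(\rho_{k,L})},L}}{\gcd\!\left(k,\,h_{p^{\alpha+\operatorname{ord}_p(\rho_{k,L})},L}\right)}. \]
   Context: For a prime $p$ and integer $x\neq0$, $\operatorname{ord}_p(x)$ is the largest integer $a$ with $p^a\mid x$. For integers $k,L\ge1$, $\rho_{k,L}=\sum_{i=0}^{k-1}10^{iL}$ (the decimal number consisting of $k$ ones with $L-1$ zeros between consecutive ones). For a prime power $p^\alpha$ with $p\notin\{2,5\}$ and an integer $L\ge1$, $h_{p^\alpha,L}$ denotes the multiplicative order of $10^L$ in the group $(\mathbb{Z}/p^{\alpha+\operatorname{ord}_p(10^L-1)}\mathbb{Z})^\times$. -}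

module Defs where

open import Data.Nat using (ℕ; zero; suc; _+_; _*_; _∸_; _^_; _<_; _≤_)
open import Data.Nat.Divisibility using (_∣_)
open import Data.Product using (_×_)
open import Relation.Nullary using (¬_)

-- ord_p(x) = a  :  p^a ∣ x  and  ¬ p^(a+1) ∣ x   (used only for x ≠ 0).
IsOrd : ℕ → ℕ → ℕ → Set
IsOrd p x a = (p ^ a ∣ x) × ¬ (p ^ suc a ∣ x)

ρ : ℕ → ℕ → ℕ
ρ zero    L = 0
ρ (suc k) L = ρ k L + 10 ^ (k * L)

IsMultOrder : ℕ → ℕ → ℕ → Set
IsMultOrder a N n =
  (0 < n) × (N ∣ a ^ n ∸ 1) × (∀ m → 0 < m → N ∣ a ^ m ∸ 1 → n ≤ m)

IsH : (p α L h : ℕ) → Set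
IsH p α L h = ∀ e → IsOrd p (10 ^ L ∸ 1) e → IsMultOrder (10 ^ L) (p ^ (α + e)) h

module Submission where

-- Since 10^(Lk) − 1 = (10^L − 1)·ρ_{k,L}, the valuation ord_p(10^(Lk) − 1) is e + r, where
-- e = ord_p(10^L − 1) and r = ord_p(ρ_{k,L}).  Hence both h-values are multiplicative orders
-- modulo the same number N = p^(α+r+e): h₂ is the order of a = 10^L and h₁ that of a^k.
-- The order of a^k is ord(a)/gcd(k, ord(a)), as in any cyclic group.

open import Defs
open import Data.Nat using (ℕ; zero; suc; _+_; _*_; _∸_; _^_; _/_; _%_; _≤_; _<_; NonZero; NonTrivial; z≤n; nonTrivial⇒nonZero; s≤s; >-nonZero; ≢-nonZero; nonTrivial⇒n>1)
open import Data.Nat.Properties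
open import Data.Nat.Divisibility
open import Data.Nat.DivMod using (m≡m%n+[m/n]*n; m%n<n; m/n*n≡m; m≥n⇒m/n>0)
open import Data.Nat.GCD using (gcd; gcd[m,n]∣m; gcd[m,n]∣n)
open import Data.Nat.Coprimality using (coprime-/gcd; coprime-divisor) renaming (sym to coprime-sym)
open import Data.Nat.Primality using (Prime; euclidsLemma; prime⇒nonZero; prime⇒nonTrivial)
open import Data.Nat.Induction using (<-wellFounded)
open import Data.Nat.Tactic.RingSolver using (solve-∀)
open import Induction.WellFounded using (Acc; acc)
open import Data.Product using (_×_; _,_; ∃; proj₁; proj₂)
open import Data.Sum using (inj₁; inj₂)
open import Data.Empty using (⊥-elim)
open import Relation.Nullary using (¬_; yes; no)
open import Relation.Binary.PropositionalEquality

*∸1≡*[∸1]+∸1 : ∀ x y .{{_ : NonZero x}} .{{_ : NonZero y}} → x * y ∸ 1 ≡ x * (y ∸ 1) + (x ∸ 1)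
*∸1≡*[∸1]+∸1 (suc x) (suc y) = identity x y
  where
  identity : ∀ x y → y + x * suc y ≡ suc x * y + x
  identity = solve-∀

module _ (a N : ℕ) .{{_ : NonZero a}} where

  ^∸1-+ : ∀ s t → a ^ (s + t) ∸ 1 ≡ a ^ s * (a ^ t ∸ 1) + (a ^ s ∸ 1)
  ^∸1-+ s t = trans (cong (_∸ 1) (^-distribˡ-+-* a s t)) (*∸1≡*[∸1]+∸1 (a ^ s) (a ^ t) {{m^n≢0 a s}} {{m^n≢0 a t}})

  ∣^∸1⇒∣^[*]∸1 : ∀ h q → N ∣ a ^ h ∸ 1 → N ∣ a ^ (q * h) ∸ 1
  ∣^∸1⇒∣^[*]∸1 h zero    _  = N ∣0
  ∣^∸1⇒∣^[*]∸1 h (suc q) dh rewrite ^∸1-+ h (q * h) =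
    ∣m∣n⇒∣m+n (∣n⇒∣m*n (a ^ h) (∣^∸1⇒∣^[*]∸1 h q dh)) dh

  ∣^[+]∸1⇒∣^∸1 : ∀ s t → N ∣ a ^ (s + t) ∸ 1 → N ∣ a ^ t ∸ 1 → N ∣ a ^ s ∸ 1
  ∣^[+]∸1⇒∣^∸1 s t ds+t dt rewrite ^∸1-+ s t = ∣m+n∣m⇒∣n ds+t (∣n⇒∣m*n (a ^ s) dt)

  multOrder∣ : ∀ {h m} → IsMultOrder a N h → N ∣ a ^ m ∸ 1 → h ∣ m
  multOrder∣ {h@(suc _)} {m} (_ , dh , least) dm with m % h | m%n<n m h | m≡m%n+[m/n]*n m h
  ... | zero  | _   | m≡ = divides (m / h) m≡
  ... | suc s | s<h | m≡ = ⊥-elim (<⇒≱ s<h (least (suc s) (s≤s z≤n)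
    (∣^[+]∸1⇒∣^∸1 (suc s) (m / h * h) (subst (λ z → N ∣ a ^ z ∸ 1) m≡ dm) (∣^∸1⇒∣^[*]∸1 h (m / h) dh))))

  ∣⇒∣^∸1 : ∀ {h m} → IsMultOrder a N h → h ∣ m → N ∣ a ^ m ∸ 1
  ∣⇒∣^∸1 {h} (_ , dh , _) (divides q refl) = ∣^∸1⇒∣^[*]∸1 h q dh

∣*⇒/gcd∣ : ∀ k h n .{{_ : NonZero (gcd k h)}} → h ∣ k * n → h / gcd k h ∣ n
∣*⇒/gcd∣ k h n h∣kn = coprime-divisor (coprime-sym (coprime-/gcd k h))
  (*-cancelʳ-∣ g (subst₂ _∣_ (sym (m/n*n≡m (gcd[m,n]∣n k h))) kn≡ h∣kn))
  where
  g = gcd k h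
  kn≡ : k * n ≡ k / g * n * g
  kn≡ = begin
    k * n           ≡⟨ cong (_* n) (sym (m/n*n≡m (gcd[m,n]∣m k h))) ⟩
    k / g * g * n   ≡⟨ *-assoc (k / g) g n ⟩
    k / g * (g * n) ≡⟨ cong (k / g *_) (*-comm g n) ⟩
    k / g * (n * g) ≡⟨ *-assoc (k / g) n g ⟨
    k / g * n * g   ∎
    where open ≡-Reasoning

∣*/gcd : ∀ k h .{{_ : NonZero (gcd k h)}} → h ∣ k * (h / gcd k h)
∣*/gcd k h = subst₂ _∣_ (m/n*n≡m (gcd[m,n]∣n k h)) (*-comm (h / gcd k h) k)
  (*-monoʳ-∣ (h / gcd k h) (gcd[m,n]∣m k h))

multOrder-^ : ∀ a N k h n .{{_ : NonZero a}} .{{_ : NonZero (gcd k h)}} →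
              IsMultOrder a N h → IsMultOrder (a ^ k) N n → n ≡ h / gcd k h
multOrder-^ a N k h n ord-a@(h>0 , _) (n>0 , dn , least) = ≤-antisym n≤h/g h/g≤n
  where
  instance _ = m^n≢0 a k
  ∣^∸1-^ : ∀ m → N ∣ a ^ (k * m) ∸ 1 → N ∣ (a ^ k) ^ m ∸ 1
  ∣^∸1-^ m = subst (λ z → N ∣ z ∸ 1) (sym (^-*-assoc a k m))
  h∣kn : h ∣ k * n
  h∣kn = multOrder∣ a N ord-a (subst (λ z → N ∣ z ∸ 1) (^-*-assoc a k n) dn)
  h/g≤n : h / gcd k h ≤ n
  h/g≤n = ∣⇒≤ {{>-nonZero n>0}} (∣*⇒/gcd∣ k h n h∣kn)
  h/g>0 : 0 < h / gcd k h
  h/g>0 = m≥n⇒m/n>0 (∣⇒≤ {{>-nonZero h>0}} (gcd[m,n]∣n k h))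
  n≤h/g : n ≤ h / gcd k h
  n≤h/g = least (h / gcd k h) h/g>0 (∣^∸1-^ _ (∣⇒∣^∸1 a N ord-a (∣*/gcd k h)))

isOrd-exists : ∀ p .{{_ : NonTrivial p}} x → x ≢ 0 → ∃ (IsOrd p x)
isOrd-exists p x = go x (<-wellFounded x)
  where
  instance _ = nonTrivial⇒nonZero p
  go : ∀ x → Acc _<_ x → x ≢ 0 → ∃ (IsOrd p x)
  go x (acc smaller) x≢0 with p ∣? x
  ... | no p∤x = 0 , divides x (sym (*-identityʳ x)) , λ d → p∤x (subst (_∣ x) (*-identityʳ p) d)
  ... | yes (divides y refl) = step (go y (smaller (m<m*n y p (nonTrivial⇒n>1 p))) y≢0)
    where
    y≢0 : y ≢ 0
    y≢0 refl = x≢0 refl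
    instance _ = ≢-nonZero y≢0
    step : ∃ (IsOrd p y) → ∃ (IsOrd p (y * p))
    step (a , pᵃ∣y , pᵃ⁺¹∤y) = suc a
      , subst (_∣ y * p) (*-comm (p ^ a) p) (*-monoˡ-∣ p pᵃ∣y)
      , λ d → pᵃ⁺¹∤y (*-cancelʳ-∣ p (subst (_∣ y * p) (*-comm p (p ^ suc a)) d))

isOrd⇒cofactor : ∀ {p x} e .{{_ : NonZero p}} → IsOrd p x e → ∃ λ q → x ≡ q * p ^ e × ¬ p ∣ q
isOrd⇒cofactor {p} e (divides q x≡ , pᵉ⁺¹∤x) = q , x≡ , λ where
  (divides t refl) → pᵉ⁺¹∤x (divides t (trans x≡ (*-assoc t p (p ^ e))))

isOrd-* : ∀ {p x y} e r → Prime p → IsOrd p x e → IsOrd p y r → IsOrd p (x * y) (e + r)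
isOrd-* {p} {x} {y} e r pp ox oy with isOrd⇒cofactor e {{prime⇒nonZero pp}} ox | isOrd⇒cofactor r {{prime⇒nonZero pp}} oy
... | q , x≡ , p∤q | q′ , y≡ , p∤q′ = divides (q * q′) xy≡ , pᵉ⁺ʳ⁺¹∤xy
  where
  instance _ = m^n≢0 p (e + r) {{prime⇒nonZero pp}}
  xy≡ : x * y ≡ q * q′ * p ^ (e + r)
  xy≡ = begin
    x * y                           ≡⟨ cong₂ _*_ x≡ y≡ ⟩
    q * p ^ e * (q′ * p ^ r)        ≡⟨ interchange q q′ (p ^ e) (p ^ r) ⟩
    q * q′ * (p ^ e * p ^ r)        ≡⟨ cong (q * q′ *_) (^-distribˡ-+-* p e r) ⟨
    q * q′ * p ^ (e + r)            ∎
    where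
    open ≡-Reasoning
    interchange : ∀ a b c d → a * c * (b * d) ≡ a * b * (c * d)
    interchange = solve-∀
  pᵉ⁺ʳ⁺¹∤xy : ¬ p ^ suc (e + r) ∣ x * y
  pᵉ⁺ʳ⁺¹∤xy d with euclidsLemma q q′ pp (*-cancelʳ-∣ (p ^ (e + r)) (subst (p * p ^ (e + r) ∣_) xy≡ d))
  ... | inj₁ p∣q  = p∤q p∣q
  ... | inj₂ p∣q′ = p∤q′ p∣q′

ρ-geometric : ∀ L k → (10 ^ L ∸ 1) * ρ k L + 1 ≡ 10 ^ (k * L)
ρ-geometric L zero = cong (_+ 1) (*-zeroʳ (10 ^ L ∸ 1))
ρ-geometric L (suc k) = begin
  u * (ρ k L + w) + 1   ≡⟨ regroup u (ρ k L) w ⟩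
  (u * ρ k L + 1) + u * w ≡⟨ cong (_+ u * w) (ρ-geometric L k) ⟩
  suc u * w             ≡⟨ cong (_* w) (trans (+-comm 1 u) (m∸n+n≡m (m^n>0 10 L))) ⟩
  10 ^ L * w            ≡⟨ ^-distribˡ-+-* 10 L (k * L) ⟨
  10 ^ (suc k * L)      ∎
  where
  open ≡-Reasoning
  u = 10 ^ L ∸ 1
  w = 10 ^ (k * L)
  regroup : ∀ u ρ w → u * (ρ + w) + 1 ≡ (u * ρ + 1) + u * w
  regroup = solve-∀

10^[L*k]∸1≡[10^L∸1]*ρ : ∀ L k → 10 ^ (L * k) ∸ 1 ≡ (10 ^ L ∸ 1) * ρ k L
10^[L*k]∸1≡[10^L∸1]*ρ L k = begin
  10 ^ (L * k) ∸ 1                ≡⟨ cong (λ m → 10 ^ m ∸ 1) (*-comm L k) ⟩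
  10 ^ (k * L) ∸ 1                ≡⟨ cong (_∸ 1) (ρ-geometric L k) ⟨
  (10 ^ L ∸ 1) * ρ k L + 1 ∸ 1    ≡⟨ m+n∸n≡m _ 1 ⟩
  (10 ^ L ∸ 1) * ρ k L            ∎
  where open ≡-Reasoning

10^L∸1≢0 : ∀ L → 1 ≤ L → 10 ^ L ∸ 1 ≢ 0
10^L∸1≢0 (suc L) _ eq = <⇒≱ (s≤s (s≤s z≤n))
  (≤-trans (*-monoʳ-≤ 10 (m^n>0 10 L)) (m∸n≡0⇒m≤n {10 ^ suc L} {1} eq))

lemma2 : (p α k L r h₁ h₂ : ℕ) → Prime p → p ≢ 2 → p ≢ 5 → 1 ≤ α → .{{_ : NonZero k}} → 1 ≤ L
    → IsOrd p (ρ k L) r → IsH p α (L * k) h₁ → IsH p (α + r) L h₂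
    → .{{_ : NonZero (gcd k h₂)}} → h₁ ≡ h₂ / gcd k h₂
-- The hypotheses p ≢ 2, p ≢ 5 and 1 ≤ α only guarantee that h₁ and h₂ exist.
lemma2 p α k L r h₁ h₂ pp _ _ _ L≥1 ord-ρ h₁-spec h₂-spec =
  multOrder-^ (10 ^ L) (p ^ (α + r + e)) k h₂ h₁ {{m^n≢0 10 L}} ord-10^L ord-10^Lᵏ
  where
  instance _ = prime⇒nonTrivial pp
  e-and-ord = isOrd-exists p (10 ^ L ∸ 1) (10^L∸1≢0 L L≥1)
  e = proj₁ e-and-ord
  ord-10^L∸1 : IsOrd p (10 ^ L ∸ 1) e
  ord-10^L∸1 = proj₂ e-and-ord
  ord-10^Lk∸1 : IsOrd p (10 ^ (L * k) ∸ 1) (e + r)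
  ord-10^Lk∸1 = subst (λ x → IsOrd p x (e + r)) (sym (10^[L*k]∸1≡[10^L∸1]*ρ L k))
    (isOrd-* e r pp ord-10^L∸1 ord-ρ)
  ord-10^L : IsMultOrder (10 ^ L) (p ^ (α + r + e)) h₂
  ord-10^L = h₂-spec e ord-10^L∸1
  ord-10^Lᵏ : IsMultOrder ((10 ^ L) ^ k) (p ^ (α + r + e)) h₁
  ord-10^Lᵏ = subst₂ (λ b m → IsMultOrder b (p ^ m) h₁) (sym (^-*-assoc 10 L k))
    (trans (cong (α +_) (+-comm e r)) (sym (+-assoc α r e))) (h₁-spec (e + r) ord-10^Lk∸1)
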